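{- Let $G$ be an outerplanar graph and let $x,y$ be vertices lying on an induced cycle $D$ of $G$ with $xy\notin E(G)$. Then the graph obtained from $G$ by adding the edge $xy$ is outerplanar.
   Context: Graphs are finite, simple and undirected. A graph is outerplanar if it admits a plane embedding with all vertices on the outer face; equivalently, it has neither $K_4$ nor $K_{2,3}$ as a minor. An induced cycle is a cycle that is an induced subgraph. -}

module Defs where

open import Data.Nat using (ℕ; zero; suc; _≤_)
open import Data.Fin using (Fin; toℕ)
import Data.Fin
open import Data.Bool using (Bool; true; false)
open import Data.Maybe using (Maybe; just; nothing)
open import Data.Product using (Σ; ∃; _×_; _,_)
open import Data.Sum using (_⊎_)
open import Relation.Nullary using (¬_)
open import Relation.Binary.PropositionalEquality using (_≡_; _≢_; refl; sym; trans)
open import Function.Bundles using (_⇔_)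

record Graph (n : ℕ) : Set₁ where
  field
    Adj    : Fin n → Fin n → Set
    Adj-sym    : ∀ {u v} → Adj u v → Adj v u
    Adj-irrefl : ∀ {u} → ¬ Adj u u
open Graph public

addEdge : ∀ {n} (G : Graph n) (x y : Fin n) → x ≢ y → Graph n
addEdge G x y x≢y = record
  { Adj    = λ u v → Adj G u v ⊎ ((u ≡ x × v ≡ y) ⊎ (u ≡ y × v ≡ x))
  ; Adj-sym    = symm
  ; Adj-irrefl = irr
  }
  where
  open import Data.Sum using (inj₁; inj₂)
  symm : ∀ {u v} → Adj G u v ⊎ ((u ≡ x × v ≡ y) ⊎ (u ≡ y × v ≡ x))
               → Adj G v u ⊎ ((v ≡ x × u ≡ y) ⊎ (v ≡ y × u ≡ x))
  symm (inj₁ a) = inj₁ (Adj-sym G a)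
  symm (inj₂ (inj₁ (p , q))) = inj₂ (inj₂ (q , p))
  symm (inj₂ (inj₂ (p , q))) = inj₂ (inj₁ (q , p))
  irr : ∀ {u} → ¬ (Adj G u u ⊎ ((u ≡ x × u ≡ y) ⊎ (u ≡ y × u ≡ x)))
  irr (inj₁ a) = Adj-irrefl G a
  irr (inj₂ (inj₁ (p , q))) = x≢y (trans (sym p) q)
  irr (inj₂ (inj₂ (p , q))) = x≢y (trans (sym q) p)

data WalkIn {n : ℕ} (G : Graph n) (P : Fin n → Set) : Fin n → Fin n → Set where
  here : ∀ {u} → P u → WalkIn G P u u
  step : ∀ {u v w} → P u → Adj G u v → WalkIn G P v w → WalkIn G P u w

-- A minor model of H in G: each vertex v of G is assigned to at most one
-- branch set (f v ≡ just i means v lies in the branch set of i; branch sets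
-- are thus automatically disjoint); branch sets are nonempty and induce
-- connected subgraphs, and each edge of H is realised by an edge of G
-- between the corresponding branch sets.
record MinorModel {m n : ℕ} (H : Graph m) (G : Graph n) : Set where
  field
    f         : Fin n → Maybe (Fin m)
    nonempty  : ∀ i → ∃ λ v → f v ≡ just i
    connected : ∀ i u v → f u ≡ just i → f v ≡ just i
                → WalkIn G (λ w → f w ≡ just i) u v
    edges     : ∀ i j → Adj H i j
                → ∃ λ u → ∃ λ v → f u ≡ just i × f v ≡ just j × Adj G u v

IsMinor : ∀ {m n} → Graph m → Graph n → Set
IsMinor H G = MinorModel H G

K4 : Graph 4
K4 = record { Adj = λ i j → i ≢ j ; Adj-sym = λ p q → p (sym q)
            ; Adj-irrefl = λ p → p refl }

side : Fin 5 → Bool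
side Data.Fin.zero = false
side (Data.Fin.suc Data.Fin.zero) = false
side _ = true

K23 : Graph 5
K23 = record { Adj = λ i j → side i ≢ side j
             ; Adj-sym = λ p q → p (sym q)
             ; Adj-irrefl = λ p → p refl }

Outerplanar : ∀ {n} → Graph n → Set
Outerplanar G = ¬ IsMinor K4 G × ¬ IsMinor K23 G

Next : ∀ {k} → Fin k → Fin k → Set
Next {k} i j = suc (toℕ i) ≡ toℕ j ⊎ (suc (toℕ i) ≡ k × toℕ j ≡ 0)

record InducedCycle {n : ℕ} (G : Graph n) : Set where
  field
    k       : ℕ
    3≤k     : 3 ≤ k
    c       : Fin k → Fin n
    inj     : ∀ i j → c i ≡ c j → i ≡ j
    induced : ∀ i j → Adj G (c i) (c j) ⇔ (Next i j ⊎ Next j i)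

OnCycle : ∀ {n} {G : Graph n} → InducedCycle G → Fin n → Set
OnCycle D x = ∃ λ i → InducedCycle.c D i ≡ x

-- Let x and y cut the induced cycle D into the arcs A and B; both are connected, both are
-- adjacent to x and to y, and no edge joins them. A walk from A to B avoiding x and y would
-- give a K_{2,3} minor of G (parts {A, B} and {x, y, walk}), so {x, y} separates the side S
-- of A from the side of B. Take a K_4 or K_{2,3} minor model of G + xy. If every branch set
-- meets the complement of S, delete S from all branch sets and replace the edge xy by the
-- path x–A–y inside the branch set of x: this is a model in G. The same works with the side
-- of B. Otherwise one branch set lies inside S and another on the opposite side. They are
-- not adjacent, which excludes K_4, and each of their common neighbours has x or y in its
-- branch set.

module Submission where

open import Defs
open import Level using (0ℓ)
open import Data.Nat
  using (ℕ; zero; suc; _+_; _∸_; _<_; _≤_; s≤s; z≤n; NonZero; >-nonZero; s≤s⁻¹)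
open import Data.Nat.Properties hiding (_≟_)
open import Data.Nat.DivMod
  using (_mod_; _%_; %-distribˡ-+; m<n⇒m%n≡m; m%n<n; n%n≡0; [m+n]%n≡m%n)
open import Data.Bool using (true; false)
open import Data.Fin using (Fin; zero; suc; toℕ; _≟_)
open import Data.Fin.Patterns using (0F; 1F; 2F; 3F; 4F)
open import Data.Fin.Properties
  using (all?; any?; ¬∀⟶∃¬; toℕ-fromℕ<; toℕ<n; toℕ-injective)
open import Data.Maybe using (Maybe; just; nothing)
open import Data.Maybe.Properties using (just-injective; ≡-dec)
open import Data.Product using (∃; ∃₂; _×_; _,_; proj₁; proj₂)
import Data.Product as Product
open import Data.Sum using (_⊎_; inj₁; inj₂; [_,_]′)
import Data.Sum as Sum
open import Data.Empty using (⊥; ⊥-elim)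
open import Function using (_∘_; id)
open import Function.Bundles using (Equivalence)
open import Relation.Nullary using (¬_; Dec; yes; no; _×-dec_; _⊎-dec_; ¬?)
open import Relation.Nullary.Decidable using (decidable-stable; ¬¬-excluded-middle)
open import Relation.Unary using (Pred; _⊆_; Decidable; ∁; _∩_)
open import Relation.Binary.Definitions using (tri<; tri≈; tri>)
open import Relation.Binary.PropositionalEquality
  using (_≡_; _≢_; refl; sym; trans; cong; subst; module ≡-Reasoning)

private
  variable
    m n : ℕ

module _ {G : Graph n} where

  walk-first : ∀ {P u v} → WalkIn G P u v → P u
  walk-first (here p)     = p
  walk-first (step p _ _) = p

  walk-last : ∀ {P u v} → WalkIn G P u v → P v
  walk-last (here p)     = p
  walk-last (step _ _ w) = walk-last w

  walk-map : ∀ {P Q : Pred (Fin n) 0ℓ} {u v} → P ⊆ Q → WalkIn G P u v → WalkIn G Q u v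
  walk-map P⊆Q (here p)     = here (P⊆Q p)
  walk-map P⊆Q (step p e w) = step (P⊆Q p) e (walk-map P⊆Q w)

  _++ʷ_ : ∀ {P u v w} → WalkIn G P u v → WalkIn G P v w → WalkIn G P u w
  here _     ++ʷ w′ = w′
  step p e w ++ʷ w′ = step p e (w ++ʷ w′)

  walk-snoc : ∀ {P u v w} → WalkIn G P u v → Adj G v w → P w → WalkIn G P u w
  walk-snoc w e p = w ++ʷ step (walk-last w) e (here p)

  walk-reverse : ∀ {P u v} → WalkIn G P u v → WalkIn G P v u
  walk-reverse (here p)     = here p
  walk-reverse (step p e w) = walk-snoc (walk-reverse w) (Adj-sym G e) p

  last-exit : ∀ {Q R : Pred (Fin n) 0ℓ} {u v} → Decidable Q → ¬ Q v → WalkIn G R u v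
            → WalkIn G (R ∩ ∁ Q) u v ⊎ ∃₂ λ a c → Q a × Adj G a c × WalkIn G (R ∩ ∁ Q) c v
  last-exit Q? ¬Qv (here r) = inj₁ (here (r , ¬Qv))
  last-exit Q? ¬Qv (step {u} r e w) with last-exit Q? ¬Qv w
  ... | inj₂ exit = inj₂ exit
  ... | inj₁ outside with Q? u
  ...   | yes Qu  = inj₂ (u , _ , Qu , e , outside)
  ...   | no ¬Qu  = inj₁ (step (r , ¬Qu) e outside)

  OnWalk : ∀ {P u v} → WalkIn G P u v → Pred (Fin n) 0ℓ
  OnWalk (here {u} _)     z = z ≡ u
  OnWalk (step {u} _ _ w) z = z ≡ u ⊎ OnWalk w z

  onWalk? : ∀ {P u v} (w : WalkIn G P u v) → Decidable (OnWalk w)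
  onWalk? (here {u} _)     z = z ≟ u
  onWalk? (step {u} _ _ w) z = (z ≟ u) ⊎-dec onWalk? w z

  onWalk⇒ : ∀ {P u v} (w : WalkIn G P u v) → OnWalk w ⊆ P
  onWalk⇒ (here p)     refl        = p
  onWalk⇒ (step p _ _) (inj₁ refl) = p
  onWalk⇒ (step _ _ w) (inj₂ z∈w)  = onWalk⇒ w z∈w

  onWalk-first : ∀ {P u v} (w : WalkIn G P u v) → OnWalk w u
  onWalk-first (here _)     = refl
  onWalk-first (step _ _ _) = inj₁ refl

  onWalk-last : ∀ {P u v} (w : WalkIn G P u v) → OnWalk w v
  onWalk-last (here _)     = refl
  onWalk-last (step _ _ w) = inj₂ (onWalk-last w)

  walk-prefix : ∀ {P u v z} (w : WalkIn G P u v) → OnWalk w z → WalkIn G (OnWalk w) u z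
  walk-prefix (here _)     refl        = here refl
  walk-prefix (step _ _ _) (inj₁ refl) = here (inj₁ refl)
  walk-prefix (step _ e w) (inj₂ z∈w)  = step (inj₁ refl) e (walk-map inj₂ (walk-prefix w z∈w))

  onWalk-connected : ∀ {P u v a b} (w : WalkIn G P u v) → OnWalk w a → OnWalk w b
                   → WalkIn G (OnWalk w) a b
  onWalk-connected w a∈w b∈w = walk-reverse (walk-prefix w a∈w) ++ʷ walk-prefix w b∈w

Avoid : Fin n → Fin n → Pred (Fin n) 0ℓ
Avoid x y v = v ≢ x × v ≢ y

module Separation (G : Graph n) (x y : Fin n) where

  XY : Pred (Fin n) 0ℓ
  XY v = v ≡ x ⊎ v ≡ y

  avoid⇒¬XY : ∀ {v} → Avoid x y v → ¬ XY v
  avoid⇒¬XY (v≢x , _) (inj₁ v≡x) = v≢x v≡x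
  avoid⇒¬XY (_ , v≢y) (inj₂ v≡y) = v≢y v≡y

  Closed : Pred (Fin n) 0ℓ → Set
  Closed X = ∀ {a b} → X a → Adj G a b → Avoid x y b → X b

  closed-neighbour : ∀ {X a b} → Closed X → X a → Adj G a b → X b ⊎ XY b
  closed-neighbour {b = b} X-closed Xa a~b with b ≟ x | b ≟ y
  ... | yes b≡x | _       = inj₂ (inj₁ b≡x)
  ... | no _    | yes b≡y = inj₂ (inj₂ b≡y)
  ... | no b≢x  | no b≢y  = inj₁ (X-closed Xa a~b (b≢x , b≢y))

  Opposite : Pred (Fin n) 0ℓ → Pred (Fin n) 0ℓ
  Opposite X = ∁ X ∩ Avoid x y

  opposite? : ∀ {X} → Decidable X → Decidable (Opposite X)
  opposite? X? v = ¬? (X? v) ×-dec (¬? (v ≟ x) ×-dec ¬? (v ≟ y))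

  opposite-closed : ∀ {X} → Closed X → Closed (Opposite X)
  opposite-closed X-closed (¬Xa , a-avoids) a~b b-avoids =
    (λ Xb → ¬Xa (X-closed Xb (Adj-sym G a~b) a-avoids)) , b-avoids

  record Links (C : Pred (Fin n) 0ℓ) : Set where
    field
      connected : ∀ {u v} → C u → C v → WalkIn G C u v
      xᶜ        : Fin n
      C-xᶜ      : C xᶜ
      xᶜ~x      : Adj G xᶜ x
      yᶜ        : Fin n
      C-yᶜ      : C yᶜ
      yᶜ~y      : Adj G yᶜ y

  record ArcPair : Set₁ where
    field
      A B            : Pred (Fin n) 0ℓ
      A?             : Decidable A
      B?             : Decidable B
      A-links        : Links A
      B-links        : Links B
      A-avoids       : A ⊆ Avoid x y
      B-avoids       : B ⊆ Avoid x y
      A-B-disjoint   : ∀ {v} → A v → ¬ B v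
      A-B-nonadjacent : ∀ {u v} → A u → B v → ¬ Adj G u v

Links-swap : ∀ {G : Graph n} {x y C} → Separation.Links G x y C → Separation.Links G y x C
Links-swap L = record
  { connected = connected
  ; xᶜ = yᶜ ; C-xᶜ = C-yᶜ ; xᶜ~x = yᶜ~y
  ; yᶜ = xᶜ ; C-yᶜ = C-xᶜ ; yᶜ~y = xᶜ~x
  }
  where open Separation.Links L

ArcPair-swap : ∀ {G : Graph n} {x y} → Separation.ArcPair G x y → Separation.ArcPair G y x
ArcPair-swap arcs = record
  { A = A ; B = B ; A? = A? ; B? = B?
  ; A-links = Links-swap A-links ; B-links = Links-swap B-links
  ; A-avoids = Product.swap ∘ A-avoids ; B-avoids = Product.swap ∘ B-avoids
  ; A-B-disjoint = A-B-disjoint ; A-B-nonadjacent = A-B-nonadjacent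
  }
  where open Separation.ArcPair arcs

module AddedEdge (G : Graph n) {x y : Fin n} (x≢y : x ≢ y) where

  open Separation G x y

  G′ : Graph n
  G′ = addEdge G x y x≢y

  closed-neighbour′ : ∀ {X a b} → Closed X → X a → Adj G′ a b → X b ⊎ XY b
  closed-neighbour′ X-closed Xa (inj₁ a~b)              = closed-neighbour X-closed Xa a~b
  closed-neighbour′ _        _  (inj₂ (inj₁ (_ , b≡y))) = inj₂ (inj₂ b≡y)
  closed-neighbour′ _        _  (inj₂ (inj₂ (_ , b≡x))) = inj₂ (inj₁ b≡x)

  exits-through-xy : ∀ {X P u v} → Closed X → X u → ¬ X v → WalkIn G′ P u v → P x ⊎ P y
  exits-through-xy _ Xu ¬Xv (here _) = ⊥-elim (¬Xv Xu)
  exits-through-xy X-closed Xu ¬Xv (step _ u~b w) with closed-neighbour′ X-closed Xu u~b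
  ... | inj₁ Xb          = exits-through-xy X-closed Xb ¬Xv w
  ... | inj₂ (inj₁ refl) = inj₁ (walk-first w)
  ... | inj₂ (inj₂ refl) = inj₂ (walk-first w)

  module Model {H : Graph m} (M : MinorModel H G′) where

    open MinorModel M

    Branch : Fin m → Pred (Fin n) 0ℓ
    Branch l v = f v ≡ just l

    Inside : Pred (Fin n) 0ℓ → Fin m → Set
    Inside X l = Branch l ⊆ X

    HasXY : Fin m → Set
    HasXY l = Branch l x ⊎ Branch l y

    same-branch : ∀ {v l k} → Branch l v → Branch k v → l ≡ k
    same-branch fv fv′ = just-injective (trans (sym fv) fv′)

    has-xy : ∀ {v l} → Branch l v → XY v → HasXY l
    has-xy fv (inj₁ refl) = inj₁ fv
    has-xy fv (inj₂ refl) = inj₂ fv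

    HasXY-pair : ∀ {p q} → HasXY p → HasXY q → p ≢ q
               → (Branch p x × Branch q y) ⊎ (Branch q x × Branch p y)
    HasXY-pair (inj₁ px) (inj₂ qy) _   = inj₁ (px , qy)
    HasXY-pair (inj₂ py) (inj₁ qx) _   = inj₂ (qx , py)
    HasXY-pair (inj₁ px) (inj₁ qx) p≢q = ⊥-elim (p≢q (same-branch px qx))
    HasXY-pair (inj₂ py) (inj₂ qy) p≢q = ⊥-elim (p≢q (same-branch py qy))

    HasXY-pigeonhole : ∀ {p q r} → HasXY p → HasXY q → HasXY r
                     → p ≢ q → q ≢ r → p ≢ r → ⊥
    HasXY-pigeonhole hp hq hr p≢q q≢r p≢r with HasXY-pair hp hq p≢q | hr
    ... | inj₁ (px , _) | inj₁ rx = p≢r (same-branch px rx)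
    ... | inj₁ (_ , qy) | inj₂ ry = q≢r (same-branch qy ry)
    ... | inj₂ (qx , _) | inj₁ rx = q≢r (same-branch qx rx)
    ... | inj₂ (_ , py) | inj₂ ry = p≢r (same-branch py ry)

    XYAvoidable : Set
    XYAvoidable = ∀ {l k} → Branch l x → Branch k y → l ≢ k × ¬ Adj H l k

    xy-avoidable-at : ∀ {p q} → Branch p x → Branch q y → p ≢ q → ¬ Adj H p q → XYAvoidable
    xy-avoidable-at px qy p≢q p≁q lx ky with same-branch px lx | same-branch qy ky
    ... | refl | refl = p≢q , p≁q

    model-avoiding-xy : XYAvoidable → MinorModel H G
    model-avoiding-xy avoidable = record
      { f         = f
      ; nonempty  = nonempty
      ; connected = λ l u v fu fv → walk-in-G (connected l u v fu fv)
      ; edges     = edges-in-G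
      }
      where
      walk-in-G : ∀ {l u v} → WalkIn G′ (Branch l) u v → WalkIn G (Branch l) u v
      walk-in-G (here fu)              = here fu
      walk-in-G (step fu (inj₁ u~v) w) = step fu u~v (walk-in-G w)
      walk-in-G (step fx (inj₂ (inj₁ (refl , refl))) w) =
        ⊥-elim (proj₁ (avoidable fx (walk-first w)) refl)
      walk-in-G (step fy (inj₂ (inj₂ (refl , refl))) w) =
        ⊥-elim (proj₁ (avoidable (walk-first w) fy) refl)

      edges-in-G : ∀ i j → Adj H i j → ∃₂ λ u v → Branch i u × Branch j v × Adj G u v
      edges-in-G i j i~j with edges i j i~j
      ... | u , v , fu , fv , inj₁ u~v                   = u , v , fu , fv , u~v
      ... | _ , _ , fx , fy , inj₂ (inj₁ (refl , refl)) = ⊥-elim (proj₂ (avoidable fx fy) i~j)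
      ... | _ , _ , fy , fx , inj₂ (inj₂ (refl , refl)) =
        ⊥-elim (proj₂ (avoidable fx fy) (Adj-sym H i~j))

    branch? : ∀ l → Decidable (Branch l)
    branch? l v = ≡-dec _≟_ (f v) (just l)

    Meets : Pred (Fin n) 0ℓ → Set
    Meets Y = ∀ l → ∃ λ v → Branch l v × Y v

    meets-outside? : ∀ {X : Pred (Fin n) 0ℓ} → Decidable X
                   → ∀ l → Dec (∃ λ v → Branch l v × ¬ X v)
    meets-outside? X? l = any? (λ v → branch? l v ×-dec ¬? (X? v))

    meets-or-inside : ∀ {X} → Decidable X → Meets (∁ X) ⊎ ∃ (Inside X)
    meets-or-inside {X} X? with all? (meets-outside? X?)
    ... | yes meets = inj₁ meets
    ... | no ¬meets with ¬∀⟶∃¬ m _ (meets-outside? X?) ¬meets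
    ...   | l , ¬meets-l =
      inj₂ (l , λ {v} fv → decidable-stable (X? v) (λ ¬Xv → ¬meets-l (v , fv , ¬Xv)))

    module Collapse {X C : Pred (Fin n) 0ℓ} (X? : Decidable X) (C? : Decidable C)
                    (X-closed : Closed X) (x∉X : ¬ X x) (y∉X : ¬ X y)
                    (C⊆X : C ⊆ X) (C-links : Links C) (meets : Meets (∁ X)) where

      open Links C-links renaming (connected to C-connected)

      f′ : Fin n → Maybe (Fin m)
      f′ v with X? v | C? v
      ... | no _  | _     = f v
      ... | yes _ | yes _ = f x
      ... | yes _ | no _  = nothing

      Branch′ : Fin m → Pred (Fin n) 0ℓ
      Branch′ l v = f′ v ≡ just l

      f′-outside : ∀ {v} → ¬ X v → f′ v ≡ f v
      f′-outside {v} ¬Xv with X? v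
      ... | no _   = refl
      ... | yes Xv = ⊥-elim (¬Xv Xv)

      f′-C : ∀ {v} → C v → f′ v ≡ f x
      f′-C {v} Cv with X? v | C? v
      ... | no ¬Xv | _      = ⊥-elim (¬Xv (C⊆X Cv))
      ... | yes _  | yes _  = refl
      ... | yes _  | no ¬Cv = ⊥-elim (¬Cv Cv)

      f′-inverse : ∀ {v l} → Branch′ l v → (¬ X v × Branch l v) ⊎ (C v × Branch l x)
      f′-inverse {v} fv with X? v | C? v
      ... | no ¬Xv | _     = inj₁ (¬Xv , fv)
      ... | yes _  | yes Cv = inj₂ (Cv , fv)
      ... | yes _  | no _   with fv
      ...   | ()

      outside-branch′ : ∀ {v l} → ¬ X v → Branch l v → Branch′ l v
      outside-branch′ ¬Xv fv = trans (f′-outside ¬Xv) fv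

      XY∉X : ∀ {v} → XY v → ¬ X v
      XY∉X (inj₁ refl) = x∉X
      XY∉X (inj₂ refl) = y∉X

      leave-X : ∀ {a b} → X a → Adj G a b → ¬ X b → XY b
      leave-X Xa a~b ¬Xb = [ ⊥-elim ∘ ¬Xb , id ]′ (closed-neighbour X-closed Xa a~b)

      C-walk : ∀ {l u v} → Branch l x → C u → C v → WalkIn G (Branch′ l) u v
      C-walk fx Cu Cv = walk-map (λ Cz → trans (f′-C Cz) fx) (C-connected Cu Cv)

      x-to-C : ∀ {l v} → Branch l x → C v → WalkIn G (Branch′ l) x v
      x-to-C fx Cv = step (outside-branch′ x∉X fx) (Adj-sym G xᶜ~x) (C-walk fx C-xᶜ Cv)

      x-to-y : ∀ {l} → Branch l x → Branch l y → WalkIn G (Branch′ l) x y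
      x-to-y fx fy = walk-snoc (x-to-C fx C-yᶜ) yᶜ~y (outside-branch′ y∉X fy)

      xy-walk : ∀ {l e z} → XY e → XY z → Branch l e → Branch l z → WalkIn G (Branch′ l) e z
      xy-walk (inj₁ refl) (inj₁ refl) fx _  = here (outside-branch′ x∉X fx)
      xy-walk (inj₁ refl) (inj₂ refl) fx fy = x-to-y fx fy
      xy-walk (inj₂ refl) (inj₁ refl) fy fx = walk-reverse (x-to-y fx fy)
      xy-walk (inj₂ refl) (inj₂ refl) fy _  = here (outside-branch′ y∉X fy)

      -- A walk of G′ inside a branch set enters and leaves X only through x and y;
      -- each such excursion, like each use of the edge xy, is replaced by the path x–C–y.
      mutual
        reroute : ∀ {l u v} → ¬ X u → WalkIn G′ (Branch l) u v → ¬ X v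
                → WalkIn G (Branch′ l) u v
        reroute ¬Xu (here fu) _ = here (outside-branch′ ¬Xu fu)
        reroute _ (step fx (inj₂ (inj₁ (refl , refl))) w) ¬Xv =
          x-to-y fx (walk-first w) ++ʷ reroute y∉X w ¬Xv
        reroute _ (step fy (inj₂ (inj₂ (refl , refl))) w) ¬Xv =
          walk-reverse (x-to-y (walk-first w) fy) ++ʷ reroute x∉X w ¬Xv
        reroute ¬Xu (step {v = b} fu (inj₁ u~b) w) ¬Xv with X? b
        ... | no ¬Xb = step (outside-branch′ ¬Xu fu) u~b (reroute ¬Xb w ¬Xv)
        ... | yes Xb = excursion (leave-X Xb (Adj-sym G u~b) ¬Xu) fu Xb w ¬Xv

        excursion : ∀ {l e b v} → XY e → Branch l e → X b → WalkIn G′ (Branch l) b v → ¬ X v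
                  → WalkIn G (Branch′ l) e v
        excursion _ _ Xb (here _) ¬Xv = ⊥-elim (¬Xv Xb)
        excursion e fe Xb (step _ b~b′ w) ¬Xv with closed-neighbour′ X-closed Xb b~b′
        ... | inj₁ Xb′ = excursion e fe Xb′ w ¬Xv
        ... | inj₂ e′  = xy-walk e e′ fe (walk-first w) ++ʷ reroute (XY∉X e′) w ¬Xv

      branch-has-xy : ∀ {w l} → Branch l w → X w ⊎ XY w → HasXY l
      branch-has-xy fw (inj₂ xy) = has-xy fw xy
      branch-has-xy {w} {l} fw (inj₁ Xw) =
        let (o , fo , ¬Xo) = meets l in exits-through-xy X-closed Xw ¬Xo (connected l w o fw fo)

      xy-edge : ∀ {l k} → Adj H l k → HasXY l → HasXY k
              → ∃₂ λ u v → Branch′ l u × Branch′ k v × Adj G u v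
      xy-edge l~k hl hk with HasXY-pair hl hk (λ { refl → Adj-irrefl H l~k })
      ... | inj₁ (lx , ky) = yᶜ , y , trans (f′-C C-yᶜ) lx , outside-branch′ y∉X ky , yᶜ~y
      ... | inj₂ (kx , ly) = y , yᶜ , outside-branch′ y∉X ly , trans (f′-C C-yᶜ) kx , Adj-sym G yᶜ~y

      edges′ : ∀ i j → Adj H i j → ∃₂ λ u v → Branch′ i u × Branch′ j v × Adj G u v
      edges′ i j i~j with edges i j i~j
      ... | _ , _ , fx , fy , inj₂ (inj₁ (refl , refl)) = xy-edge i~j (inj₁ fx) (inj₂ fy)
      ... | _ , _ , fy , fx , inj₂ (inj₂ (refl , refl)) = xy-edge i~j (inj₂ fy) (inj₁ fx)
      ... | u , v , fu , fv , inj₁ u~v with X? u | X? v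
      ...   | no ¬Xu | no ¬Xv = u , v , outside-branch′ ¬Xu fu , outside-branch′ ¬Xv fv , u~v
      ...   | yes Xu | _      =
        xy-edge i~j (branch-has-xy fu (inj₁ Xu))
                    (branch-has-xy fv (closed-neighbour X-closed Xu u~v))
      ...   | no _   | yes Xv =
        xy-edge i~j (branch-has-xy fu (closed-neighbour X-closed Xv (Adj-sym G u~v)))
                    (branch-has-xy fv (inj₁ Xv))

      connected′ : ∀ l u v → Branch′ l u → Branch′ l v → WalkIn G (Branch′ l) u v
      connected′ l u v fu fv with f′-inverse fu | f′-inverse fv
      ... | inj₁ (¬Xu , gu) | inj₁ (¬Xv , gv) = reroute ¬Xu (connected l u v gu gv) ¬Xv
      ... | inj₁ (¬Xu , gu) | inj₂ (Cv , fx)  =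
        reroute ¬Xu (connected l u x gu fx) x∉X ++ʷ x-to-C fx Cv
      ... | inj₂ (Cu , fx)  | inj₁ (¬Xv , gv) =
        walk-reverse (x-to-C fx Cu) ++ʷ reroute x∉X (connected l x v fx gv) ¬Xv
      ... | inj₂ (Cu , fx)  | inj₂ (Cv , _)   = C-walk fx Cu Cv

      collapsed : MinorModel H G
      collapsed = record
        { f         = f′
        ; nonempty  = λ l → let (v , fv , ¬Xv) = meets l in v , outside-branch′ ¬Xv fv
        ; connected = connected′
        ; edges     = edges′
        }

    module Separated {S : Pred (Fin n) 0ℓ} (S-closed : Closed S)
                     {l k : Fin m} (l⊆S : Inside S l) (k⊆opposite : Inside (Opposite S) k) where

      distinct : l ≢ k
      distinct refl = let (v , fv) = nonempty l in proj₁ (k⊆opposite fv) (l⊆S fv)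

      nonadjacent : ¬ Adj H l k
      nonadjacent l~k with edges l k l~k
      ... | u , v , fu , fv , u~v = [ proj₁ (k⊆opposite fv) , avoid⇒¬XY (proj₂ (k⊆opposite fv)) ]′
                                      (closed-neighbour′ S-closed (l⊆S fu) u~v)

      common-has-xy : ∀ p → Adj H p l → Adj H p k → HasXY p
      common-has-xy p p~l p~k with edges p l p~l | edges p k p~k
      ... | u , v , fu , fv , u~v | u′ , v′ , fu′ , fv′ , u′~v′
        with closed-neighbour′ S-closed (l⊆S fv) (Adj-sym G′ u~v)
           | closed-neighbour′ (opposite-closed S-closed) (k⊆opposite fv′) (Adj-sym G′ u′~v′)
      ... | inj₂ xy | _       = has-xy fu xy
      ... | inj₁ _  | inj₂ xy = has-xy fu′ xy
      ... | inj₁ Su | inj₁ opposite-u′ =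
        exits-through-xy S-closed Su (proj₁ opposite-u′) (connected p u u′ fu fu′)

  module _ (M : MinorModel K23 G′) where

    open Model M

    K23-xy-avoidable : ∀ {l k} → ¬ Adj K23 l k → (∀ p → Adj K23 p l → Adj K23 p k → HasXY p)
                     → XYAvoidable
    -- The with-abstraction also rewrites side l and side k in the types of l≁k and common.
    K23-xy-avoidable {l} {k} l≁k common with side l | side k
    ... | false | true  = ⊥-elim (l≁k λ ())
    ... | true  | false = ⊥-elim (l≁k λ ())
    ... | false | false = ⊥-elim (HasXY-pigeonhole (common 2F (λ ()) (λ ()))
                                                  (common 3F (λ ()) (λ ()))
                                                  (common 4F (λ ()) (λ ()))
                                                  (λ ()) (λ ()) (λ ()))
    ... | true  | true  with HasXY-pair (common 0F (λ ()) (λ ())) (common 1F (λ ()) (λ ())) (λ ())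
    ...   | inj₁ (x∈0 , y∈1) = xy-avoidable-at x∈0 y∈1 (λ ()) (λ 0≁1 → 0≁1 refl)
    ...   | inj₂ (x∈1 , y∈0) = xy-avoidable-at x∈1 y∈0 (λ ()) (λ 1≁0 → 1≁0 refl)

module Bridging {G : Graph n} {x y : Fin n} (x≢y : x ≢ y) (arcs : Separation.ArcPair G x y) where

  open Separation G x y
  open ArcPair arcs
  module LA = Links A-links
  module LB = Links B-links

  Between : Pred (Fin n) 0ℓ
  Between = (Avoid x y ∩ ∁ A) ∩ ∁ B

  record Bridge : Set where
    field
      a c d b : Fin n
      A-a     : A a
      a~c     : Adj G a c
      path    : WalkIn G Between c d
      d~b     : Adj G d b
      B-b     : B b

  bridge : ∀ {a b} → A a → B b → WalkIn G (Avoid x y) a b → Bridge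
  bridge Aa Bb w with last-exit A? (λ Ab → A-B-disjoint Ab Bb) w
  ... | inj₁ outside = ⊥-elim (proj₂ (walk-first outside) Aa)
  ... | inj₂ (a′ , c , Aa′ , a′~c , w₁)
    with last-exit B? (λ Bc → A-B-nonadjacent Aa′ Bc a′~c) (walk-reverse w₁)
  ...   | inj₁ outside = ⊥-elim (proj₂ (walk-first outside) Bb)
  ...   | inj₂ (b′ , d , Bb′ , b′~d , w₂) = record
    { A-a = Aa′ ; a~c = a′~c ; path = walk-reverse w₂ ; d~b = Adj-sym G b′~d ; B-b = Bb′ }

  module FromBridge (br : Bridge) where

    open Bridge br

    Class : Fin 5 → Pred (Fin n) 0ℓ
    Class 0F = A
    Class 1F = B
    Class 2F = _≡ x
    Class 3F = _≡ y
    Class 4F = OnWalk path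

    path-avoids : ∀ {v} → OnWalk path v → Avoid x y v
    path-avoids = proj₁ ∘ proj₁ ∘ onWalk⇒ path

    path-∉A : ∀ {v} → OnWalk path v → ¬ A v
    path-∉A = proj₂ ∘ proj₁ ∘ onWalk⇒ path

    path-∉B : ∀ {v} → OnWalk path v → ¬ B v
    path-∉B = proj₂ ∘ onWalk⇒ path

    classify : Fin n → Maybe (Fin 5)
    classify v with A? v | B? v | v ≟ x | v ≟ y | onWalk? path v
    ... | yes _ | _     | _     | _     | _     = just 0F
    ... | no _  | yes _ | _     | _     | _     = just 1F
    ... | no _  | no _  | yes _ | _     | _     = just 2F
    ... | no _  | no _  | no _  | yes _ | _     = just 3F
    ... | no _  | no _  | no _  | no _  | yes _ = just 4F
    ... | no _  | no _  | no _  | no _  | no _  = nothing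

    classify-sound : ∀ {i v} → classify v ≡ just i → Class i v
    classify-sound {v = v} _ with A? v | B? v | v ≟ x | v ≟ y | onWalk? path v
    classify-sound refl | yes Av | _      | _       | _       | _      = Av
    classify-sound refl | no _   | yes Bv | _       | _       | _      = Bv
    classify-sound refl | no _   | no _   | yes v≡x | _       | _      = v≡x
    classify-sound refl | no _   | no _   | no _    | yes v≡y | _      = v≡y
    classify-sound refl | no _   | no _   | no _    | no _    | yes on = on

    classify-complete : ∀ i {v} → Class i v → classify v ≡ just i
    classify-complete i {v} _ with A? v | B? v | v ≟ x | v ≟ y | onWalk? path v
    classify-complete 0F _    | yes _  | _      | _      | _      | _ = refl
    classify-complete 0F Av   | no ¬Av | _      | _      | _      | _ = ⊥-elim (¬Av Av)
    classify-complete 1F Bv   | yes Av | _      | _      | _      | _ = ⊥-elim (A-B-disjoint Av Bv)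
    classify-complete 1F _    | no _   | yes _  | _      | _      | _ = refl
    classify-complete 1F Bv   | no _   | no ¬Bv | _      | _      | _ = ⊥-elim (¬Bv Bv)
    classify-complete 2F refl | yes Ax | _      | _      | _      | _ = ⊥-elim (proj₁ (A-avoids Ax) refl)
    classify-complete 2F refl | no _   | yes Bx | _      | _      | _ = ⊥-elim (proj₁ (B-avoids Bx) refl)
    classify-complete 2F _    | no _   | no _   | yes _  | _      | _ = refl
    classify-complete 2F refl | no _   | no _   | no x≢x | _      | _ = ⊥-elim (x≢x refl)
    classify-complete 3F refl | yes Ay | _      | _      | _      | _ = ⊥-elim (proj₂ (A-avoids Ay) refl)
    classify-complete 3F refl | no _   | yes By | _      | _      | _ = ⊥-elim (proj₂ (B-avoids By) refl)
    classify-complete 3F refl | no _   | no _   | yes y≡x | _     | _ = ⊥-elim (x≢y (sym y≡x))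
    classify-complete 3F _    | no _   | no _   | no _   | yes _  | _ = refl
    classify-complete 3F refl | no _   | no _   | no _   | no y≢y | _ = ⊥-elim (y≢y refl)
    classify-complete 4F on   | yes Av | _      | _      | _      | _ = ⊥-elim (path-∉A on Av)
    classify-complete 4F on   | no _   | yes Bv | _      | _      | _ = ⊥-elim (path-∉B on Bv)
    classify-complete 4F on   | no _   | no _   | yes v≡x | _     | _ = ⊥-elim (proj₁ (path-avoids on) v≡x)
    classify-complete 4F on   | no _   | no _   | no _   | yes v≡y | _ = ⊥-elim (proj₂ (path-avoids on) v≡y)
    classify-complete 4F _    | no _   | no _   | no _   | no _   | yes _ = refl
    classify-complete 4F on   | no _   | no _   | no _   | no _   | no off = ⊥-elim (off on)

    class-nonempty : ∀ i → ∃ (Class i)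
    class-nonempty 0F = a , A-a
    class-nonempty 1F = b , B-b
    class-nonempty 2F = x , refl
    class-nonempty 3F = y , refl
    class-nonempty 4F = c , onWalk-first path

    class-connected : ∀ i {u v} → Class i u → Class i v → WalkIn G (Class i) u v
    class-connected 0F = LA.connected
    class-connected 1F = LB.connected
    class-connected 2F refl refl = here refl
    class-connected 3F refl refl = here refl
    class-connected 4F = onWalk-connected path

    ClassEdge : Fin 5 → Fin 5 → Set
    ClassEdge i j = ∃₂ λ u v → Class i u × Class j v × Adj G u v

    class-edge-across : ∀ i j → side i ≡ false → side j ≡ true → ClassEdge i j
    class-edge-across 0F 2F _ _ = LA.xᶜ , x , LA.C-xᶜ , refl , LA.xᶜ~x
    class-edge-across 0F 3F _ _ = LA.yᶜ , y , LA.C-yᶜ , refl , LA.yᶜ~y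
    class-edge-across 0F 4F _ _ = a , c , A-a , onWalk-first path , a~c
    class-edge-across 1F 2F _ _ = LB.xᶜ , x , LB.C-xᶜ , refl , LB.xᶜ~x
    class-edge-across 1F 3F _ _ = LB.yᶜ , y , LB.C-yᶜ , refl , LB.yᶜ~y
    class-edge-across 1F 4F _ _ = b , d , B-b , onWalk-last path , Adj-sym G d~b
    class-edge-across 0F 0F _ ()
    class-edge-across 0F 1F _ ()
    class-edge-across 1F 0F _ ()
    class-edge-across 1F 1F _ ()
    class-edge-across 2F _ () _
    class-edge-across 3F _ () _
    class-edge-across 4F _ () _

    class-edge : ∀ i j → Adj K23 i j → ClassEdge i j
    class-edge i j i~j with side i in si | side j in sj
    ... | false | true  = class-edge-across i j si sj
    ... | true  | false = let (u , v , p , q , u~v) = class-edge-across j i sj si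
                          in v , u , q , p , Adj-sym G u~v
    ... | false | false = ⊥-elim (i~j refl)
    ... | true  | true  = ⊥-elim (i~j refl)

    model : MinorModel K23 G
    model = record
      { f         = classify
      ; nonempty  = λ i → let (v , p) = class-nonempty i in v , classify-complete i p
      ; connected = λ i u v fu fv →
          walk-map (classify-complete i) (class-connected i (classify-sound fu) (classify-sound fv))
      ; edges     = λ i j i~j → let (u , v , p , q , u~v) = class-edge i j i~j in
          u , v , classify-complete i p , classify-complete j q , u~v
      }

  separated : ¬ MinorModel K23 G → ∀ {a b} → A a → B b → ¬ WalkIn G (Avoid x y) a b
  separated K23-free Aa Bb w = K23-free (FromBridge.model (bridge Aa Bb w))

¬¬-decidable : (R : Pred (Fin n) 0ℓ) → ¬ ¬ Decidable R
¬¬-decidable {zero}  R ¬dec = ¬dec λ ()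
¬¬-decidable {suc n} R ¬dec = ¬¬-excluded-middle λ R0? → ¬¬-decidable (R ∘ suc) λ Rs? →
  ¬dec λ { zero → R0? ; (suc v) → Rs? v }

module Chord {G : Graph n} {x y : Fin n} (x≢y : x ≢ y) (G-outerplanar : Outerplanar G)
             (arcs : Separation.ArcPair G x y) where

  open Separation G x y
  open AddedEdge G x≢y
  open ArcPair arcs

  Reachable : Pred (Fin n) 0ℓ
  Reachable v = ∃ λ a → A a × WalkIn G (Avoid x y) a v

  reachable-closed : Closed Reachable
  reachable-closed (a , Aa , w) a~b b-avoids = a , Aa , walk-snoc w a~b b-avoids

  A⊆reachable : A ⊆ Reachable
  A⊆reachable Av = _ , Av , here (A-avoids Av)

  B⊆opposite : B ⊆ Opposite Reachable
  B⊆opposite Bv = (λ (_ , Aa , w) → Bridging.separated x≢y arcs (proj₂ G-outerplanar) Aa Bv w)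
                , B-avoids Bv

  x∉reachable : ¬ Reachable x
  x∉reachable (_ , _ , w) = proj₁ (walk-last w) refl

  y∉reachable : ¬ Reachable y
  y∉reachable (_ , _ , w) = proj₂ (walk-last w) refl

  module _ {H : Graph m} (M : MinorModel H G′) where

    open Model M

    OnBothSides : Set
    OnBothSides = ∃₂ λ l k → Inside Reachable l × Inside (Opposite Reachable) k

    split : Decidable Reachable → MinorModel H G ⊎ OnBothSides
    split R? with meets-or-inside R?
    ... | inj₁ meets = inj₁ (Collapse.collapsed R? A? reachable-closed x∉reachable y∉reachable
                                                A⊆reachable A-links meets)
    ... | inj₂ (l , l-inside) with meets-or-inside (opposite? R?)
    ...   | inj₁ meets =
      inj₁ (Collapse.collapsed (opposite? R?) B? (opposite-closed reachable-closed)
                               (λ (_ , x≢x , _) → x≢x refl) (λ (_ , _ , y≢y) → y≢y refl)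
                               B⊆opposite B-links meets)
    ...   | inj₂ (k , k-inside) = inj₂ (l , k , l-inside , k-inside)

  -- Adjacency, hence Reachable, need not be decidable; as the goals are negations,
  -- ¬¬-decidable lets us assume it is.
  no-K4 : ¬ MinorModel K4 G′
  no-K4 M = ¬¬-decidable Reachable λ R? → [ proj₁ G-outerplanar , both-sides ]′ (split M R?)
    where
    both-sides : ¬ OnBothSides M
    both-sides (_ , _ , l-inside , k-inside) = nonadjacent distinct
      where open Model.Separated M reachable-closed l-inside k-inside

  no-K23 : ¬ MinorModel K23 G′
  no-K23 M = ¬¬-decidable Reachable λ R? → [ proj₂ G-outerplanar , both-sides ]′ (split M R?)
    where
    both-sides : ¬ OnBothSides M
    both-sides (_ , _ , l-inside , k-inside) =
      proj₂ G-outerplanar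
            (Model.model-avoiding-xy M (K23-xy-avoidable M nonadjacent common-has-xy))
      where open Model.Separated M reachable-closed l-inside k-inside

  addEdge-outerplanar : Outerplanar G′
  addEdge-outerplanar = no-K4 , no-K23

-- Cycle positions are read modulo k, so that the arc from y back round to x is an
-- interval of ℕ just like the arc from x to y.
module CycleArcs {G : Graph n} (D : InducedCycle G) where

  open InducedCycle D

  instance
    k-nonZero : NonZero k
    k-nonZero = >-nonZero (≤-trans (s≤s z≤n) 3≤k)

  vertex : ℕ → Fin n
  vertex r = c (r mod k)

  toℕ-mod : ∀ r → toℕ (r mod k) ≡ r % k
  toℕ-mod r = toℕ-fromℕ< (m%n<n r k)

  toℕ-mod-< : ∀ {r} → r < k → toℕ (r mod k) ≡ r
  toℕ-mod-< {r} r<k = trans (toℕ-mod r) (m<n⇒m%n≡m r<k)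

  vertex-toℕ : ∀ i → vertex (toℕ i) ≡ c i
  vertex-toℕ i = cong c (toℕ-injective (toℕ-mod-< (toℕ<n i)))

  vertex-k+ : ∀ r → vertex (k + r) ≡ vertex r
  vertex-k+ r = cong c (toℕ-injective (begin
    toℕ ((k + r) mod k) ≡⟨ toℕ-mod (k + r) ⟩
    (k + r) % k         ≡⟨ cong (_% k) (+-comm k r) ⟩
    (r + k) % k         ≡⟨ [m+n]%n≡m%n r k ⟩
    r % k               ≡⟨ toℕ-mod r ⟨
    toℕ (r mod k)       ∎))
    where open ≡-Reasoning

  %-suc : ∀ r → suc r % k ≡ suc (r % k) % k
  %-suc r = trans (%-distribˡ-+ 1 r k) (cong (λ o → (o + r % k) % k) (m<n⇒m%n≡m 1<k))
    where
    1<k : 1 < k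
    1<k = ≤-trans (s≤s (s≤s z≤n)) 3≤k

  suc-% : ∀ r → suc r % k ≡ suc (r % k) ⊎ (suc (r % k) ≡ k × suc r % k ≡ 0)
  suc-% r with m≤n⇒m<n∨m≡n (m%n<n r k)
  ... | inj₁ 1+r%k<k = inj₁ (trans (%-suc r) (m<n⇒m%n≡m 1+r%k<k))
  ... | inj₂ 1+r%k≡k = inj₂ (1+r%k≡k , (begin
    suc r % k       ≡⟨ %-suc r ⟩
    suc (r % k) % k ≡⟨ cong (_% k) 1+r%k≡k ⟩
    k % k           ≡⟨ n%n≡0 k ⟩
    0               ∎))
    where open ≡-Reasoning

  next⇒adjacent : ∀ {i j} → Next i j → Adj G (c i) (c j)
  next⇒adjacent i→j = Equivalence.from (induced _ _) (inj₁ i→j)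

  toℕ-injective-c : ∀ {i j} → c i ≡ c j → toℕ i ≡ toℕ j
  toℕ-injective-c ci≡cj = cong toℕ (inj _ _ ci≡cj)

  vertex-adjacent : ∀ r → Adj G (vertex r) (vertex (suc r))
  vertex-adjacent r = next⇒adjacent (Sum.map next wrap (suc-% r))
    where
    next : suc r % k ≡ suc (r % k) → suc (toℕ (r mod k)) ≡ toℕ (suc r mod k)
    next e = trans (cong suc (toℕ-mod r)) (trans (sym e) (sym (toℕ-mod (suc r))))
    wrap : suc (r % k) ≡ k × suc r % k ≡ 0
         → suc (toℕ (r mod k)) ≡ k × toℕ (suc r mod k) ≡ 0
    wrap (e , e′) = trans (cong suc (toℕ-mod r)) e , trans (toℕ-mod (suc r)) e′

  vertex-adjacent-+ : ∀ s j → Adj G (vertex (s + j)) (vertex (s + suc j))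
  vertex-adjacent-+ s j =
    subst (λ r → Adj G (vertex (s + j)) (vertex r)) (sym (+-suc s j)) (vertex-adjacent (s + j))

  Arc : ℕ → ℕ → Pred (Fin n) 0ℓ
  Arc s ℓ v = ∃ λ i → i < ℓ × vertex (s + i) ≡ v

  arc? : ∀ s ℓ → Decidable (Arc s ℓ)
  arc? s ℓ v = anyUpTo? (λ i → vertex (s + i) ≟ v) ℓ

  arc-walk-up : ∀ {s ℓ i} j → i ≤ j → j < ℓ → WalkIn G (Arc s ℓ) (vertex (s + i)) (vertex (s + j))
  arc-walk-up j i≤j j<ℓ with m≤n⇒m<n∨m≡n i≤j
  ... | inj₂ refl = here (j , j<ℓ , refl)
  arc-walk-up zero    _ _   | inj₁ ()
  arc-walk-up {s} (suc j) _ j<ℓ | inj₁ i<1+j =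
    walk-snoc (arc-walk-up j (s≤s⁻¹ i<1+j) (<⇒≤ j<ℓ)) (vertex-adjacent-+ s j) (suc j , j<ℓ , refl)

  arc-connected : ∀ {s ℓ u v} → Arc s ℓ u → Arc s ℓ v → WalkIn G (Arc s ℓ) u v
  arc-connected (i , i<ℓ , refl) (j , j<ℓ , refl) with ≤-total i j
  ... | inj₁ i≤j = arc-walk-up j i≤j j<ℓ
  ... | inj₂ j≤i = walk-reverse (arc-walk-up i j≤i i<ℓ)

  arc-start-adjacent : ∀ r → Adj G (vertex (suc r + 0)) (vertex r)
  arc-start-adjacent r = subst (λ s → Adj G (vertex s) (vertex r)) (sym (+-identityʳ (suc r)))
                               (Adj-sym G (vertex-adjacent r))

  -- With P = toℕ p < Q = toℕ q, the arcs are A = {P+1, …, P+1+a} and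
  -- B = {Q+1, …, Q+1+b} (mod k), where P+2+a = Q and Q+2+b = k+P.
  module Cut (p q : Fin k) (p<q : toℕ p < toℕ q) (p≁q : ¬ Adj G (c p) (c q)) where

    P Q : ℕ
    P = toℕ p
    Q = toℕ q

    Q<k : Q < k
    Q<k = toℕ<n q

    1+P<Q : suc P < Q
    1+P<Q = ≤∧≢⇒< p<q λ 1+P≡Q → p≁q (next⇒adjacent (inj₁ 1+P≡Q))

    1+Q<k+P : suc Q < k + P
    1+Q<k+P with m≤n⇒m<n∨m≡n Q<k
    ... | inj₁ 1+Q<k = <-≤-trans 1+Q<k (m≤m+n k P)
    ... | inj₂ 1+Q≡k = subst (_< k + P) (trans (+-identityʳ k) (sym 1+Q≡k)) (+-monoʳ-< k 0<P)
      where
      0<P : 0 < P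
      0<P = n≢0⇒n>0 λ P≡0 → p≁q (Adj-sym G (next⇒adjacent (inj₂ (1+Q≡k , P≡0))))

    a b : ℕ
    a = proj₁ (m≤n⇒∃[o]m+o≡n 1+P<Q)
    b = proj₁ (m≤n⇒∃[o]m+o≡n 1+Q<k+P)

    2+P+a≡Q : suc (suc P) + a ≡ Q
    2+P+a≡Q = proj₂ (m≤n⇒∃[o]m+o≡n 1+P<Q)

    2+Q+b≡k+P : suc (suc Q) + b ≡ k + P
    2+Q+b≡k+P = proj₂ (m≤n⇒∃[o]m+o≡n 1+Q<k+P)

    A B : Pred (Fin n) 0ℓ
    A = Arc (suc P) (suc a)
    B = Arc (suc Q) (suc b)

    A-position : ∀ {v} → A v → ∃ λ j → (P < toℕ j × toℕ j < Q) × c j ≡ v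
    A-position (i , i<1+a , refl) =
      (suc P + i) mod k , subst (λ r → P < r × r < Q) (sym (toℕ-mod-< (<-trans r<Q Q<k)))
                                (m≤m+n (suc P) i , r<Q) , refl
      where
      r<Q : suc P + i < Q
      r<Q = subst (suc P + i <_) (trans (+-suc (suc P) a) 2+P+a≡Q) (+-monoʳ-< (suc P) i<1+a)

    B-position : ∀ {v} → B v → ∃ λ j → (toℕ j < P ⊎ Q < toℕ j) × c j ≡ v
    B-position (i , i<1+b , refl) with suc Q + i <? k
    ... | yes r<k = _ , inj₂ (subst (Q <_) (sym (toℕ-mod-< r<k)) (m≤m+n (suc Q) i)) , refl
    ... | no r≮k  = _ , inj₁ (subst (_< P) (sym toℕ≡t) t<P) , refl
      where
      r t : ℕ
      r = suc Q + i
      t = r ∸ k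

      t+k≡r : t + k ≡ r
      t+k≡r = m∸n+n≡m (≮⇒≥ r≮k)

      r<P+k : r < P + k
      r<P+k = subst (r <_) (trans (trans (+-suc (suc Q) b) 2+Q+b≡k+P) (+-comm k P))
                    (+-monoʳ-< (suc Q) i<1+b)

      t<P : t < P
      t<P = +-cancelʳ-< k t P (subst (_< P + k) (sym t+k≡r) r<P+k)

      toℕ≡t : toℕ (r mod k) ≡ t
      toℕ≡t = begin
        toℕ (r mod k) ≡⟨ toℕ-mod r ⟩
        r % k         ≡⟨ cong (_% k) t+k≡r ⟨
        (t + k) % k   ≡⟨ [m+n]%n≡m%n t k ⟩
        t % k         ≡⟨ m<n⇒m%n≡m (<-trans t<P (<-trans p<q Q<k)) ⟩
        t             ∎
        where open ≡-Reasoning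

    A-avoids : ∀ {v} → A v → Avoid (c p) (c q) v
    A-avoids Av with A-position Av
    ... | j , (P<j , j<Q) , refl = (λ cj≡cp → <-irrefl (sym (toℕ-injective-c cj≡cp)) P<j)
                                 , (λ cj≡cq → <-irrefl (toℕ-injective-c cj≡cq) j<Q)

    B-avoids : ∀ {v} → B v → Avoid (c p) (c q) v
    B-avoids Bv with B-position Bv
    ... | j , inj₁ j<P , refl = (λ cj≡cp → <-irrefl (toℕ-injective-c cj≡cp) j<P)
                              , (λ cj≡cq → <-asym p<q (subst (_< P) (toℕ-injective-c cj≡cq) j<P))
    ... | j , inj₂ Q<j , refl = (λ cj≡cp → <-asym p<q (subst (Q <_) (toℕ-injective-c cj≡cp) Q<j))
                              , (λ cj≡cq → <-irrefl (sym (toℕ-injective-c cj≡cq)) Q<j)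

    A-B-disjoint : ∀ {v} → A v → ¬ B v
    A-B-disjoint Av Bv with A-position Av | B-position Bv
    ... | j , (P<j , _) , refl | j′ , inj₁ j′<P , cj′≡cj =
      <-asym P<j (subst (_< P) (toℕ-injective-c cj′≡cj) j′<P)
    ... | j , (_ , j<Q) , refl | j′ , inj₂ Q<j′ , cj′≡cj =
      <-asym j<Q (subst (Q <_) (toℕ-injective-c cj′≡cj) Q<j′)

    A-B-nonadjacent : ∀ {u v} → A u → B v → ¬ Adj G u v
    A-B-nonadjacent Au Bv u~v with A-position Au | B-position Bv
    ... | i , (P<i , i<Q) , refl | j , j-out , refl with Equivalence.to (induced i j) u~v
    ...   | inj₁ (inj₁ 1+i≡j) =
      [ (λ j<P → <-asym (<-trans P<i (n<1+n _)) (subst (_< P) (sym 1+i≡j) j<P))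
      , (λ Q<j → <⇒≱ Q<j (subst (_≤ Q) 1+i≡j i<Q)) ]′ j-out
    ...   | inj₁ (inj₂ (1+i≡k , _)) = <-irrefl 1+i≡k (≤-<-trans i<Q Q<k)
    ...   | inj₂ (inj₁ 1+j≡i) =
      [ (λ j<P → <⇒≱ P<i (subst (_≤ P) 1+j≡i j<P))
      , (λ Q<j → <-asym i<Q (subst (Q <_) 1+j≡i (<-trans Q<j (n<1+n _)))) ]′ j-out
    ...   | inj₂ (inj₂ (_ , i≡0)) = <-irrefl (sym i≡0) (≤-<-trans z≤n P<i)

    A-links : Separation.Links G (c p) (c q) A
    A-links = record
      { connected = arc-connected
      ; xᶜ = vertex (suc P + 0) ; C-xᶜ = 0 , s≤s z≤n , refl
      ; xᶜ~x = subst (Adj G _) (vertex-toℕ p) (arc-start-adjacent P)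
      ; yᶜ = vertex (suc P + a) ; C-yᶜ = a , ≤-refl , refl
      ; yᶜ~y = subst (Adj G _) (trans (cong vertex 2+P+a≡Q) (vertex-toℕ q))
                     (vertex-adjacent (suc P + a))
      }

    B-links : Separation.Links G (c p) (c q) B
    B-links = record
      { connected = arc-connected
      ; xᶜ = vertex (suc Q + b) ; C-xᶜ = b , ≤-refl , refl
      ; xᶜ~x = subst (Adj G _) (trans (cong vertex 2+Q+b≡k+P) (trans (vertex-k+ P) (vertex-toℕ p)))
                     (vertex-adjacent (suc Q + b))
      ; yᶜ = vertex (suc Q + 0) ; C-yᶜ = 0 , s≤s z≤n , refl
      ; yᶜ~y = subst (Adj G _) (vertex-toℕ q) (arc-start-adjacent Q)
      }

    arcs : Separation.ArcPair G (c p) (c q)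
    arcs = record
      { A = A ; B = B ; A? = arc? (suc P) (suc a) ; B? = arc? (suc Q) (suc b)
      ; A-links = A-links ; B-links = B-links
      ; A-avoids = A-avoids ; B-avoids = B-avoids
      ; A-B-disjoint = A-B-disjoint ; A-B-nonadjacent = A-B-nonadjacent
      }

lemma6 : ∀ {n : ℕ} (G : Graph n) (x y : Fin n) (x≢y : x ≢ y)
         → Outerplanar G
         → (D : InducedCycle G) → OnCycle D x → OnCycle D y
         → ¬ Adj G x y
         → Outerplanar (addEdge G x y x≢y)
lemma6 G x y x≢y G-outerplanar D (p , refl) (q , refl) x≁y with <-cmp (toℕ p) (toℕ q)
... | tri< p<q _ _ = Chord.addEdge-outerplanar x≢y G-outerplanar
                       (CycleArcs.Cut.arcs D p q p<q x≁y)
... | tri≈ _ p≡q _ = ⊥-elim (x≢y (cong (InducedCycle.c D) (toℕ-injective p≡q)))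
... | tri> _ _ q<p = Chord.addEdge-outerplanar x≢y G-outerplanar
                       (ArcPair-swap (CycleArcs.Cut.arcs D q p q<p (x≁y ∘ Adj-sym G)))
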